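{- For every $n\ge 0$ there is a bijection $\Phi:\mathcal{HM}_{n}\to\mathcal{SM}_{n}^{U*}$ such that, whenever $(M,P)\in\mathcal{HM}_{n}$ and $L=\Phi(M,P)$, the Motzkin path $M$ has exactly $k$ humps if and only if $L\in\mathcal{SM}_{n}^{UU}(k-1)\cup\mathcal{SM}_{n}^{UD}(k)$.
   Context: A Motzkin path of order $n$ is a lattice path from $(0,0)$ to $(n,0)$ with steps $U=(1,1)$, $D=(1,-1)$, $F=(1,0)$ that never goes below the $x$-axis; $\mathcal{M}_n$ denotes the set of these. A super Motzkin path of order $n$ is such a path (from $(0,0)$ to $(n,0)$ with steps $U,D,F$) with no restriction on going below the $x$-axis; $\mathcal{SM}_n$ denotes the set of these. A hump of a path is a maximal-pattern occurrence of consecutive steps consisting of a $U$ step, followed by zero or more $F$ steps, followed by a $D$ step (i.e. a factor $UF^jD$, $j\ge 0$). $\mathcal{HM}_n=\{(M,P): M\in\mathcal{M}_n,\ P \text{ is a hump of } M\}$. $\mathcal{SM}_n^{U*}$ is the set of paths in $\mathcal{SM}_n$ whose first non-flat (i.e. non-$F$) step is $U$. $\mathcal{SM}_n^{UU}(k)$ (resp. $\mathcal{SM}_n^{UD}(k)$) is the set of paths in $\mathcal{SM}_n$ with exactly $k$ humps whose first non-flat step is $U$ and whose last non-flat step is $U$ (resp. $D$). -}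

module Defs where

open import Data.Nat using (ℕ; zero; suc; _+_)
open import Data.Bool using (Bool; true; false; _∧_; if_then_else_; T)
open import Data.List using (List; []; _∷_; length; drop; reverse; upTo; filter)
open import Data.Maybe using (Maybe; just; nothing)
open import Data.Integer using (ℤ; +_; _≟_; _<?_) renaming (_+_ to _+ℤ_; -_ to -ℤ_)
open import Data.Product using (Σ; _×_)
open import Relation.Nullary.Decidable using (⌊_⌋)
open import Relation.Binary.PropositionalEquality using (_≡_)

-- Steps of a lattice path: U = (1,1), D = (1,-1), F = (1,0).
data Step : Set where
  U D F : Step

Path : Set
Path = List Step

δ : Step → ℤ
δ U = + 1
δ D = -ℤ (+ 1)
δ F = + 0

height : Path → ℤ
height []      = + 0
height (s ∷ w) = δ s +ℤ height w

nonNeg : ℤ → Path → Bool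
nonNeg h []      = true
nonNeg h (s ∷ w) = if ⌊ (h +ℤ δ s) <? + 0 ⌋ then false else nonNeg (h +ℤ δ s) w

isSuperMotzkin : ℕ → Path → Bool
isSuperMotzkin n w = ⌊ Data.Nat._≟_ (length w) n ⌋ ∧ ⌊ height w ≟ + 0 ⌋

isMotzkin : ℕ → Path → Bool
isMotzkin n w = isSuperMotzkin n w ∧ nonNeg (+ 0) w

startsFD : Path → Bool
startsFD (D ∷ _) = true
startsFD (F ∷ w) = startsFD w
startsFD _       = false

isHumpAt : Path → ℕ → Bool
isHumpAt w i with drop i w
... | U ∷ w' = startsFD w'
... | _      = false

HumpAt : Path → ℕ → Set
HumpAt w i = T (isHumpAt w i)

numHumps : Path → ℕ
numHumps w = length (filter (λ i → isHumpAt w i Data.Bool.≟ true) (upTo (length w)))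

firstNonFlat : Path → Maybe Step
firstNonFlat []      = nothing
firstNonFlat (F ∷ w) = firstNonFlat w
firstNonFlat (s ∷ w) = just s

lastNonFlat : Path → Maybe Step
lastNonFlat w = firstNonFlat (reverse w)

𝓜 : ℕ → Set
𝓜 n = Σ Path (λ M → T (isMotzkin n M))

-- 𝓗𝓜_n = {(M,P) : M ∈ 𝓜_n, P a hump of M}; a hump is identified by its start position
𝓗𝓜 : ℕ → Set
𝓗𝓜 n = Σ (𝓜 n) (λ M → Σ ℕ (λ i → HumpAt (Σ.proj₁ M) i))

𝓢𝓜U* : ℕ → Set
𝓢𝓜U* n = Σ Path (λ L → T (isSuperMotzkin n L) × firstNonFlat L ≡ just U)

-- membership in 𝓢𝓜_n^{UU}(k) and 𝓢𝓜_n^{UD}(k) (the order n is given by L ∈ 𝓢𝓜_n)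
InUU : ℕ → Path → Set
InUU k L = numHumps L ≡ k × firstNonFlat L ≡ just U × lastNonFlat L ≡ just U

InUD : ℕ → Path → Set
InUD k L = numHumps L ≡ k × firstNonFlat L ≡ just U × lastNonFlat L ≡ just D

module Submission where

-- Both 𝓗𝓜 n and 𝓢𝓜U* n are put in bijection with 𝓢 n = 𝓝 n ⊎ 𝓓 n, where 𝓝 n
-- holds the Motzkin paths with a non-flat step and 𝓓 n the Motzkin paths X D Y
-- with a marked D after which Y has a non-flat step.
-- α : 𝓗𝓜 n ≅ 𝓢 n cuts M at the last D before the marked hump (M ∈ 𝓝 n if there
--   is none); conversely the hump is the first hump of M, resp. of Y.
-- β : 𝓢𝓜U* n ≅ 𝓢 n keeps L if it never goes below the axis, and otherwise
--   writes L = Y D X with D the first step reaching the global minimum and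
--   rotates it to the Motzkin path X D Y.
-- Φ = β⁻¹ ∘ α. Since humps (X D Y) = humps X + [X ends with U] + humps Y and Y
-- ends with D, L = Y D X has one hump fewer than M = X D Y if X ends with U
-- (then L ends with U) and as many otherwise (then L ends with D).

open import Defs
open import Data.Nat using (ℕ; zero; suc; _+_; _≤_; _<_; z≤n; s≤s)
import Data.Nat as ℕ
import Data.Nat.Properties as ℕP
open import Data.Nat.Tactic.RingSolver using (solve-∀)
open import Data.Integer using (+_) renaming (_+_ to _+ℤ_)
import Data.Integer as ℤ
import Data.Integer.Properties as ℤP
open import Data.Bool using (Bool; true; false; T)
import Data.Bool as B
open import Data.Bool.Properties using (T-∧; T-irrelevant)
open import Data.Unit using (tt)
open import Data.Empty using (⊥; ⊥-elim)
open import Data.Maybe using (Maybe; just; nothing; _<∣>_)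
open import Data.Maybe.Properties using (<∣>-assoc; <∣>-identityʳ)
open import Data.List using (List; []; _∷_; _++_; [_]; length; take; drop; reverse; filter; applyUpTo)
import Data.List.Properties as LP
open import Data.Product using (Σ; ∃; _×_; _,_; proj₁; proj₂)
open import Data.Sum using (_⊎_; inj₁; inj₂)
open import Function.Definitions using (Bijective)
open import Function.Bundles using (_⇔_; _↔_; mk⇔; mk↔ₛ′; Bijection; Equivalence)
open import Function.Properties.Inverse using (↔⇒⤖)
open import Relation.Nullary.Decidable using (toWitness; fromWitness; ⌊_⌋)
open import Relation.Binary.PropositionalEquality hiding ([_])
open import Axiom.UniquenessOfIdentityProofs.WithK using (uip)

data Meander : ℕ → Path → ℕ → Set where
  end  : ∀ {h} → Meander h [] h
  up   : ∀ {h w e} → Meander (suc h) w e → Meander h (U ∷ w) e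
  flat : ∀ {h w e} → Meander h w e → Meander h (F ∷ w) e
  down : ∀ {h w e} → Meander h w e → Meander (suc h) (D ∷ w) e

meander-++ : ∀ {h m e xs ys} → Meander h xs m → Meander m ys e → Meander h (xs ++ ys) e
meander-++ end      q = q
meander-++ (up p)   q = up (meander-++ p q)
meander-++ (flat p) q = flat (meander-++ p q)
meander-++ (down p) q = down (meander-++ p q)

meander-split : ∀ {h e} xs {ys} → Meander h (xs ++ ys) e → ∃ λ m → Meander h xs m × Meander m ys e
meander-split []       p        = _ , end , p
meander-split (U ∷ xs) (up p)   = let m , p₁ , p₂ = meander-split xs p in m , up p₁ , p₂
meander-split (F ∷ xs) (flat p) = let m , p₁ , p₂ = meander-split xs p in m , flat p₁ , p₂
meander-split (D ∷ xs) (down p) = let m , p₁ , p₂ = meander-split xs p in m , down p₁ , p₂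

meander-raise : ∀ {h w e} → Meander h w e → Meander (suc h) w (suc e)
meander-raise end      = end
meander-raise (up p)   = up (meander-raise p)
meander-raise (flat p) = flat (meander-raise p)
meander-raise (down p) = down (meander-raise p)

-- The height change along a path does not depend on the starting level.
meander-rigid : ∀ {h e h' e' w} → Meander h w e → Meander h' w e' → h + e' ≡ h' + e
meander-rigid {h} {_} {h'} end end = ℕP.+-comm h h'
meander-rigid (up p)   (up q)   = ℕP.suc-injective (meander-rigid p q)
meander-rigid (flat p) (flat q) = meander-rigid p q
meander-rigid (down p) (down q) = cong suc (meander-rigid p q)

rise-fall-⊥ : ∀ {a m w} → Meander 0 w (suc m) → Meander a w 0 → ⊥
rise-fall-⊥ {a} p q = ℕP.m+1+n≢0 a (meander-rigid q p)

flat-meander : ∀ {h e} w → firstNonFlat w ≡ nothing → Meander h w e → h ≡ e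
flat-meander []      _  end      = refl
flat-meander (F ∷ w) eq (flat p) = flat-meander w eq p

nonNeg-up : ∀ h w → nonNeg (+ h) (U ∷ w) ≡ nonNeg (+ suc h) w
nonNeg-up h w = cong (λ x → nonNeg (+ x) w) (ℕP.+-comm h 1)

nonNeg-flat : ∀ h w → nonNeg (+ h) (F ∷ w) ≡ nonNeg (+ h) w
nonNeg-flat h w = cong (λ x → nonNeg (+ x) w) (ℕP.+-identityʳ h)

meander⇒nonNeg : ∀ {h w e} → Meander h w e → T (nonNeg (+ h) w)
meander⇒nonNeg end                     = tt
meander⇒nonNeg {h} (up {w = w} p)      = subst T (sym (nonNeg-up h w)) (meander⇒nonNeg p)
meander⇒nonNeg {h} (flat {w = w} p)    = subst T (sym (nonNeg-flat h w)) (meander⇒nonNeg p)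
meander⇒nonNeg (down p)                = meander⇒nonNeg p

nonNeg⇒meander : ∀ h w → T (nonNeg (+ h) w) → ∃ (Meander h w)
nonNeg⇒meander h       []      t = h , end
nonNeg⇒meander h       (U ∷ w) t = let e , p = nonNeg⇒meander (suc h) w (subst T (nonNeg-up h w) t) in e , up p
nonNeg⇒meander h       (F ∷ w) t = let e , p = nonNeg⇒meander h w (subst T (nonNeg-flat h w) t) in e , flat p
nonNeg⇒meander (suc h) (D ∷ w) t = let e , p = nonNeg⇒meander h w t in e , down p

height-++ : ∀ xs ys → height (xs ++ ys) ≡ height xs +ℤ height ys
height-++ []       ys = sym (ℤP.+-identityˡ _)
height-++ (s ∷ xs) ys = trans (cong (δ s +ℤ_) (height-++ xs ys)) (sym (ℤP.+-assoc (δ s) _ _))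

meander-height : ∀ {h w e} → Meander h w e → + h +ℤ height w ≡ + e
meander-height {h} end = ℤP.+-identityʳ (+ h)
meander-height {h} (up {w = w} p) = begin
  + h +ℤ (+ 1 +ℤ height w)  ≡⟨ sym (ℤP.+-assoc (+ h) (+ 1) (height w)) ⟩
  + (h ℕ.+ 1) +ℤ height w   ≡⟨ cong (λ x → + x +ℤ height w) (ℕP.+-comm h 1) ⟩
  + suc h +ℤ height w       ≡⟨ meander-height p ⟩
  _                         ∎
  where open ≡-Reasoning
meander-height {h} (flat {w = w} p) = trans (cong (+ h +ℤ_) (ℤP.+-identityˡ (height w))) (meander-height p)
meander-height {suc h} (down {w = w} p) = trans (sym (ℤP.+-assoc (+ suc h) (ℤ.- + 1) (height w))) (meander-height p)

meander-level : ∀ {h w e} → Meander h w e → height w ≡ + 0 → e ≡ h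
meander-level {h} {w} {e} p h0 = ℤP.+-injective (begin
  + e            ≡⟨ sym (meander-height p) ⟩
  + h +ℤ height w ≡⟨ cong (+ h +ℤ_) h0 ⟩
  + h +ℤ + 0     ≡⟨ ℤP.+-identityʳ (+ h) ⟩
  + h            ∎)
  where open ≡-Reasoning

superMotzkin-∧ : ∀ n w → T (isSuperMotzkin n w) ⇔ (T ⌊ length w ℕ.≟ n ⌋ × T ⌊ height w ℤ.≟ + 0 ⌋)
superMotzkin-∧ n w = T-∧ {⌊ length w ℕ.≟ n ⌋} {⌊ height w ℤ.≟ + 0 ⌋}

motzkin-∧ : ∀ n w → T (isMotzkin n w) ⇔ (T (isSuperMotzkin n w) × T (nonNeg (+ 0) w))
motzkin-∧ n w = T-∧ {isSuperMotzkin n w} {nonNeg (+ 0) w}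

superMotzkin⇒ : ∀ {n w} → T (isSuperMotzkin n w) → length w ≡ n × height w ≡ + 0
superMotzkin⇒ {n} {w} t = let l , h = Equivalence.to (superMotzkin-∧ n w) t in toWitness l , toWitness h

⇒superMotzkin : ∀ {n w} → length w ≡ n → height w ≡ + 0 → T (isSuperMotzkin n w)
⇒superMotzkin {n} {w} l h = Equivalence.from (superMotzkin-∧ n w) (fromWitness l , fromWitness h)

motzkin⇒superMotzkin : ∀ {n w} → T (isMotzkin n w) → T (isSuperMotzkin n w)
motzkin⇒superMotzkin {n} {w} t = proj₁ (Equivalence.to (motzkin-∧ n w) t)

motzkin⇒ : ∀ {n w} → T (isMotzkin n w) → length w ≡ n × Meander 0 w 0
motzkin⇒ {n} {w} t with Equivalence.to (motzkin-∧ n w) t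
... | sm , nn with superMotzkin⇒ {n} {w} sm | nonNeg⇒meander 0 w nn
... | l , h0 | e , p = l , subst (Meander 0 w) (meander-level p h0) p

⇒motzkin : ∀ {n w} → length w ≡ n → Meander 0 w 0 → T (isMotzkin n w)
⇒motzkin {n} {w} l p = Equivalence.from (motzkin-∧ n w)
  (⇒superMotzkin {n} {w} l (trans (sym (ℤP.+-identityˡ _)) (meander-height p)) , meander⇒nonNeg p)

firstNonFlat-++ : ∀ xs ys → firstNonFlat (xs ++ ys) ≡ firstNonFlat xs <∣> firstNonFlat ys
firstNonFlat-++ []       ys = refl
firstNonFlat-++ (U ∷ xs) ys = refl
firstNonFlat-++ (F ∷ xs) ys = firstNonFlat-++ xs ys
firstNonFlat-++ (D ∷ xs) ys = refl

firstNonFlat≢F : ∀ w → firstNonFlat w ≢ just F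
firstNonFlat≢F (F ∷ w) eq = firstNonFlat≢F w eq

-- The last non-flat step, computed by recursion from the front of the path:
-- a non-flat step further right takes precedence.
lastNF : Path → Maybe Step
lastNF []      = nothing
lastNF (s ∷ w) = lastNF w <∣> firstNonFlat [ s ]

lastNonFlat≡lastNF : ∀ w → lastNonFlat w ≡ lastNF w
lastNonFlat≡lastNF []      = refl
lastNonFlat≡lastNF (s ∷ w) = begin
  firstNonFlat (reverse (s ∷ w))        ≡⟨ cong firstNonFlat (LP.unfold-reverse s w) ⟩
  firstNonFlat (reverse w ++ [ s ])     ≡⟨ firstNonFlat-++ (reverse w) [ s ] ⟩
  lastNonFlat w <∣> firstNonFlat [ s ]  ≡⟨ cong (_<∣> firstNonFlat [ s ]) (lastNonFlat≡lastNF w) ⟩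
  lastNF w <∣> firstNonFlat [ s ]       ∎
  where open ≡-Reasoning

lastNF-++ : ∀ xs ys → lastNF (xs ++ ys) ≡ lastNF ys <∣> lastNF xs
lastNF-++ []       ys = sym (<∣>-identityʳ (lastNF ys))
lastNF-++ (s ∷ xs) ys = trans (cong (_<∣> firstNonFlat [ s ]) (lastNF-++ xs ys))
                              (<∣>-assoc (lastNF ys) (lastNF xs) (firstNonFlat [ s ]))

lastNF≢F : ∀ w → lastNF w ≢ just F
lastNF≢F (s ∷ w) eq with lastNF w in e
... | just t  = lastNF≢F w (trans e eq)
... | nothing = firstNonFlat≢F [ s ] eq

lastNF-flat : ∀ w → lastNF w ≡ nothing → firstNonFlat w ≡ nothing
lastNF-flat []      _  = refl
lastNF-flat (s ∷ w) eq with lastNF w in e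
lastNF-flat (F ∷ w) eq | nothing = lastNF-flat w e

lastNF-U⇒positive : ∀ {h e} w → Meander h w e → lastNF w ≡ just U → 0 < e
lastNF-U⇒positive (s ∷ w) p eq with lastNF w in e
lastNF-U⇒positive (U ∷ w) (up p)   eq | just _ = lastNF-U⇒positive w p (trans e eq)
lastNF-U⇒positive (F ∷ w) (flat p) eq | just _ = lastNF-U⇒positive w p (trans e eq)
lastNF-U⇒positive (D ∷ w) (down p) eq | just _ = lastNF-U⇒positive w p (trans e eq)
lastNF-U⇒positive (U ∷ w) (up p)   eq | nothing =
  subst (0 <_) (flat-meander w (lastNF-flat w e) p) (s≤s z≤n)

meander-lastNF-D : ∀ {h} w → Meander h w 0 → firstNonFlat w ≡ just U → lastNF w ≡ just D
meander-lastNF-D w p first with lastNF w in e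
... | just U  = ⊥-elim (ℕP.<-irrefl refl (lastNF-U⇒positive w p e))
... | just D  = refl
... | just F  = ⊥-elim (lastNF≢F w e)
... | nothing with trans (sym (lastNF-flat w e)) first
...   | ()

startsHump : Path → Bool
startsHump (U ∷ w) = startsFD w
startsHump _       = false

isHumpAt-drop : ∀ w i → isHumpAt w i ≡ startsHump (drop i w)
isHumpAt-drop w i with drop i w
... | []    = refl
... | U ∷ _ = refl
... | F ∷ _ = refl
... | D ∷ _ = refl

indicator : Bool → ℕ
indicator true  = 1
indicator false = 0

humpCount : Path → ℕ
humpCount []      = 0
humpCount (s ∷ w) = indicator (startsHump (s ∷ w)) + humpCount w

countBelow : (ℕ → Bool) → ℕ → ℕ
countBelow f zero    = 0
countBelow f (suc n) = indicator (f 0) + countBelow (λ i → f (suc i)) n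

countBelow-cong : ∀ {f g} n → (∀ i → f i ≡ g i) → countBelow f n ≡ countBelow g n
countBelow-cong zero    eq = refl
countBelow-cong (suc n) eq = cong₂ _+_ (cong indicator (eq 0)) (countBelow-cong n (λ i → eq (suc i)))

length-filter-applyUpTo : ∀ (f : ℕ → Bool) (g : ℕ → ℕ) n →
  length (filter (λ i → f i B.≟ true) (applyUpTo g n)) ≡ countBelow (λ i → f (g i)) n
length-filter-applyUpTo f g zero = refl
length-filter-applyUpTo f g (suc n) with f (g 0)
... | true  = cong suc (length-filter-applyUpTo f (λ i → g (suc i)) n)
... | false = length-filter-applyUpTo f (λ i → g (suc i)) n

numHumps≡humpCount : ∀ w → numHumps w ≡ humpCount w
numHumps≡humpCount w = trans (length-filter-applyUpTo (isHumpAt w) (λ i → i) (length w)) (count w)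
  where
    -- a hump at position i + 1 of s ∷ w is a hump at position i of w
    count : ∀ w → countBelow (isHumpAt w) (length w) ≡ humpCount w
    count []      = refl
    count (s ∷ w) = cong₂ _+_ (cong indicator (isHumpAt-drop (s ∷ w) 0))
      (trans (countBelow-cong (length w) (λ i → trans (isHumpAt-drop (s ∷ w) (suc i)) (sym (isHumpAt-drop w i))))
             (count w))

-- "X ends with an up step": the contribution of the boundary to a hump count.
endsUp : Maybe Step → ℕ
endsUp (just U) = 1
endsUp _        = 0

startsFD-flat-++D : ∀ A Z → lastNF A ≡ nothing → startsFD (A ++ D ∷ Z) ≡ true × startsFD A ≡ false
startsFD-flat-++D []      Z _  = refl , refl
startsFD-flat-++D (s ∷ A) Z eq with lastNF A in e
startsFD-flat-++D (F ∷ A) Z eq | nothing = startsFD-flat-++D A Z e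

startsFD-nonflat-++D : ∀ A Z {t} → lastNF A ≡ just t → startsFD (A ++ D ∷ Z) ≡ startsFD A
startsFD-nonflat-++D (U ∷ A) Z _ = refl
startsFD-nonflat-++D (D ∷ A) Z _ = refl
startsFD-nonflat-++D (F ∷ A) Z eq with lastNF A in e
... | just _ = startsFD-nonflat-++D A Z e

-- The hump starting at the front of s ∷ A either lies inside s ∷ A or uses
-- the appended D, the latter exactly when s = U and A is flat.
hump-boundary : ∀ s A Z →
  indicator (startsHump (s ∷ A ++ D ∷ Z)) + endsUp (lastNF A) ≡
  indicator (startsHump (s ∷ A)) + endsUp (lastNF (s ∷ A))
hump-boundary s A Z with lastNF A in e
hump-boundary U A Z | nothing rewrite proj₁ (startsFD-flat-++D A Z e) | proj₂ (startsFD-flat-++D A Z e) = refl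
hump-boundary U A Z | just _  rewrite startsFD-nonflat-++D A Z e = refl
hump-boundary F A Z | nothing = refl
hump-boundary F A Z | just _  = refl
hump-boundary D A Z | nothing = refl
hump-boundary D A Z | just _  = refl

humpCount-++D : ∀ X Y → humpCount (X ++ D ∷ Y) ≡ (humpCount X + endsUp (lastNF X)) + humpCount Y
humpCount-++D []      Y = refl
humpCount-++D (s ∷ A) Y = begin
  b′ + humpCount (A ++ D ∷ Y)  ≡⟨ cong (λ x → b′ + x) (humpCount-++D A Y) ⟩
  b′ + ((h + u) + humpCount Y) ≡⟨ +-shuffle b′ h u (humpCount Y) ⟩
  ((b′ + u) + h) + humpCount Y ≡⟨ cong (λ x → (x + h) + humpCount Y) (hump-boundary s A Y) ⟩
  ((b + u′) + h) + humpCount Y ≡⟨ +-swap b u′ h (humpCount Y) ⟩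
  ((b + h) + u′) + humpCount Y ∎
  where
    open ≡-Reasoning
    b′ = indicator (startsHump (s ∷ A ++ D ∷ Y))
    b  = indicator (startsHump (s ∷ A))
    h  = humpCount A
    u  = endsUp (lastNF A)
    u′ = endsUp (lastNF (s ∷ A))
    +-shuffle : ∀ a b c d → a + ((b + c) + d) ≡ ((a + c) + b) + d
    +-shuffle = solve-∀
    +-swap : ∀ a b c d → ((a + b) + c) + d ≡ ((a + c) + b) + d
    +-swap = solve-∀

noD : Path → Bool
noD []      = true
noD (D ∷ _) = false
noD (_ ∷ w) = noD w

DFree : Path → Set
DFree w = T (noD w)

-- A D-free prefix P followed by a suffix R beginning with a hump: R begins
-- at the first hump of P ++ R.
HumpSplit : Path → Set
HumpSplit w = Σ (Path × Path) λ (P , R) → w ≡ P ++ R × DFree P × T (startsHump R)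

firstNonFlat-D⇒startsFD : ∀ w → firstNonFlat w ≡ just D → startsFD w ≡ true
firstNonFlat-D⇒startsFD (D ∷ w) _  = refl
firstNonFlat-D⇒startsFD (F ∷ w) eq = firstNonFlat-D⇒startsFD w eq

firstHump : ∀ {h e} w → firstNonFlat w ≡ just U → Meander h w e → e ≤ h → HumpSplit w
firstHump (F ∷ w) first (flat p) e≤h =
  let (P , R) , eq , P-free , hump = firstHump w first p e≤h in (F ∷ P , R) , cong (F ∷_) eq , P-free , hump
firstHump {h} (U ∷ w) first (up p) e≤h with firstNonFlat w in next
... | just U = let (P , R) , eq , P-free , hump = firstHump w next p (ℕP.m≤n⇒m≤1+n e≤h)
               in (U ∷ P , R) , cong (U ∷_) eq , P-free , hump
... | just D = ([] , U ∷ w) , refl , tt , subst T (sym (firstNonFlat-D⇒startsFD w next)) tt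
... | just F = ⊥-elim (firstNonFlat≢F w next)
... | nothing = ⊥-elim (ℕP.1+n≰n (subst (_≤ h) (sym (flat-meander w next p)) e≤h))

firstNonFlat-humpSplit : ∀ P R → DFree P → T (startsHump R) → firstNonFlat (P ++ R) ≡ just U
firstNonFlat-humpSplit []      (U ∷ R) _      _    = refl
firstNonFlat-humpSplit (U ∷ P) R       _      _    = refl
firstNonFlat-humpSplit (F ∷ P) R       P-free hump = firstNonFlat-humpSplit P R P-free hump

startsFD-humpSplit : ∀ P R → DFree P → T (startsHump R) → startsFD (P ++ R) ≡ false
startsFD-humpSplit []      (U ∷ R) _      _    = refl
startsFD-humpSplit (U ∷ P) R       _      _    = refl
startsFD-humpSplit (F ∷ P) R       P-free hump = startsFD-humpSplit P R P-free hump

humpSplit-unique : ∀ P₁ P₂ {R₁ R₂} → P₁ ++ R₁ ≡ P₂ ++ R₂ → DFree P₁ → DFree P₂ →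
                   T (startsHump R₁) → T (startsHump R₂) → P₁ ≡ P₂
humpSplit-unique []       []       _    _  _  _  _  = refl
humpSplit-unique []       (U ∷ P₂) {R₂ = R₂} refl _ f₂ h₁ h₂ =
  ⊥-elim (subst T (startsFD-humpSplit P₂ R₂ f₂ h₂) h₁)
humpSplit-unique (U ∷ P₁) []       {R₁} refl f₁ _ h₁ h₂ =
  ⊥-elim (subst T (startsFD-humpSplit P₁ R₁ f₁ h₁) h₂)
humpSplit-unique []       (F ∷ P₂) refl _ _ () _
humpSplit-unique (F ∷ P₁) []       refl _ _ _ ()
humpSplit-unique (s ∷ P₁) (t ∷ P₂) eq f₁ f₂ h₁ h₂ with LP.∷-injective eq
humpSplit-unique (U ∷ P₁) (U ∷ P₂) _ f₁ f₂ h₁ h₂ | refl , eq =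
  cong (U ∷_) (humpSplit-unique P₁ P₂ eq f₁ f₂ h₁ h₂)
humpSplit-unique (F ∷ P₁) (F ∷ P₂) _ f₁ f₂ h₁ h₂ | refl , eq =
  cong (F ∷_) (humpSplit-unique P₁ P₂ eq f₁ f₂ h₁ h₂)

LastDSplit : Path → Set
LastDSplit w = Σ (Path × Path) λ (X , G) → w ≡ X ++ D ∷ G × DFree G

lastD : ∀ w → DFree w ⊎ LastDSplit w
lastD []      = inj₁ tt
lastD (s ∷ w) with lastD w
... | inj₂ ((X , G) , eq , G-free) = inj₂ ((s ∷ X , G) , cong (s ∷_) eq , G-free)
lastD (U ∷ w) | inj₁ w-free = inj₁ w-free
lastD (F ∷ w) | inj₁ w-free = inj₁ w-free
lastD (D ∷ w) | inj₁ w-free = inj₂ (([] , w) , refl , w-free)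

DFree-++D-⊥ : ∀ X G → DFree (X ++ D ∷ G) → ⊥
DFree-++D-⊥ (U ∷ X) G free = DFree-++D-⊥ X G free
DFree-++D-⊥ (F ∷ X) G free = DFree-++D-⊥ X G free

lastD-unique : ∀ X₁ X₂ {G₁ G₂} → X₁ ++ D ∷ G₁ ≡ X₂ ++ D ∷ G₂ → DFree G₁ → DFree G₂ →
               X₁ ≡ X₂ × G₁ ≡ G₂
lastD-unique []        []        eq _  _  = refl , LP.∷-injectiveʳ eq
lastD-unique []        (_ ∷ X₂) {G₂ = G₂} eq f₁ _ =
  ⊥-elim (DFree-++D-⊥ X₂ G₂ (subst DFree (LP.∷-injectiveʳ eq) f₁))
lastD-unique (_ ∷ X₁) []        {G₁} eq _ f₂ =
  ⊥-elim (DFree-++D-⊥ X₁ G₁ (subst DFree (sym (LP.∷-injectiveʳ eq)) f₂))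
lastD-unique (s ∷ X₁) (t ∷ X₂)  eq f₁ f₂ with LP.∷-injective eq
... | refl , eq′ = let X-eq , G-eq = lastD-unique X₁ X₂ eq′ f₁ f₂ in cong (s ∷_) X-eq , G-eq

-- The split Y D X at the first step reaching the global minimum: Y stays
-- weakly above its final level a below its start, X stays weakly above its start.
MinSplit : Path → Set
MinSplit w = Σ ℕ λ a → Σ (Path × Path) λ (Y , X) → w ≡ Y ++ D ∷ X × Meander a Y 0 × ∃ (Meander 0 X)

minSplit : ∀ w → ∃ (Meander 0 w) ⊎ MinSplit w
minSplit [] = inj₁ (0 , end)
minSplit (U ∷ w) with minSplit w
... | inj₁ (e , p) = inj₁ (suc e , up (meander-raise p))
... | inj₂ (zero  , (Y , X) , refl , q , e , r) = inj₁ (e , up (meander-++ (meander-raise q) (down r)))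
... | inj₂ (suc a , (Y , X) , refl , q , r)     = inj₂ (a , (U ∷ Y , X) , refl , up q , r)
minSplit (F ∷ w) with minSplit w
... | inj₁ (e , p) = inj₁ (e , flat p)
... | inj₂ (a , (Y , X) , refl , q , r) = inj₂ (a , (F ∷ Y , X) , refl , flat q , r)
minSplit (D ∷ w) with minSplit w
... | inj₁ r = inj₂ (0 , ([] , w) , refl , end , r)
... | inj₂ (a , (Y , X) , refl , q , r) = inj₂ (suc a , (D ∷ Y , X) , refl , down q , r)

minSplit-end : ∀ {a e Y X} → height (Y ++ D ∷ X) ≡ + 0 → Meander a Y 0 → Meander 0 X e → e ≡ suc a
minSplit-end h0 q r = meander-level (meander-++ (meander-raise q) (down r)) h0

minSplit-nonneg-⊥ : ∀ {a e} Y X → Meander 0 (Y ++ D ∷ X) e → Meander a Y 0 → ⊥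
minSplit-nonneg-⊥ Y X p q with meander-split Y p
... | zero  , _  , ()
... | suc m , pY , _ = rise-fall-⊥ pY q

++D-cases : ∀ (Y₁ Y₂ X₁ X₂ : Path) → Y₁ ++ D ∷ X₁ ≡ Y₂ ++ D ∷ X₂ →
  Y₁ ≡ Y₂ ⊎ (Σ Path λ Z → Y₂ ≡ Y₁ ++ D ∷ Z × X₁ ≡ Z ++ D ∷ X₂)
          ⊎ (Σ Path λ Z → Y₁ ≡ Y₂ ++ D ∷ Z × X₂ ≡ Z ++ D ∷ X₁)
++D-cases []       []       X₁ X₂ eq = inj₁ refl
++D-cases []       (_ ∷ Y₂) X₁ X₂ eq with LP.∷-injective eq
... | refl , eq′ = inj₂ (inj₁ (Y₂ , refl , eq′))
++D-cases (_ ∷ Y₁) []       X₁ X₂ eq with LP.∷-injective eq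
... | refl , eq′ = inj₂ (inj₂ (Y₁ , refl , sym eq′))
++D-cases (s ∷ Y₁) (_ ∷ Y₂) X₁ X₂ eq with LP.∷-injective eq
... | refl , eq′ with ++D-cases Y₁ Y₂ X₁ X₂ eq′
...   | inj₁ Y-eq                    = inj₁ (cong (s ∷_) Y-eq)
...   | inj₂ (inj₁ (Z , Y-eq , X-eq)) = inj₂ (inj₁ (Z , cong (s ∷_) Y-eq , X-eq))
...   | inj₂ (inj₂ (Z , Y-eq , X-eq)) = inj₂ (inj₂ (Z , cong (s ∷_) Y-eq , X-eq))

-- Two minimum splits cannot have one D strictly before the other: the
-- segment Z between them would both fall to and rise from the same level.
minSplit-overlap-⊥ : ∀ {a e} Y Z X → Meander a (Y ++ D ∷ Z) 0 → Meander 0 (Z ++ D ∷ X) e → ⊥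
minSplit-overlap-⊥ Y Z X p q with meander-split Y p | meander-split Z q
... | zero  , _ , ()      | _
... | suc m , _ , down pZ | zero  , _  , ()
... | suc m , _ , down pZ | suc k , qZ , _ = rise-fall-⊥ qZ pZ

minSplit-unique : ∀ {a₁ a₂ e₁ e₂} Y₁ Y₂ X₁ X₂ → Y₁ ++ D ∷ X₁ ≡ Y₂ ++ D ∷ X₂ →
  Meander a₁ Y₁ 0 → Meander 0 X₁ e₁ → Meander a₂ Y₂ 0 → Meander 0 X₂ e₂ → Y₁ ≡ Y₂ × X₁ ≡ X₂
minSplit-unique Y₁ Y₂ X₁ X₂ eq q₁ r₁ q₂ r₂ with ++D-cases Y₁ Y₂ X₁ X₂ eq
... | inj₁ refl = refl , LP.∷-injectiveʳ (LP.++-cancelˡ Y₁ _ _ eq)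
... | inj₂ (inj₁ (Z , refl , refl)) = ⊥-elim (minSplit-overlap-⊥ Y₁ Z X₂ q₂ r₁)
... | inj₂ (inj₂ (Z , refl , refl)) = ⊥-elim (minSplit-overlap-⊥ Y₂ Z X₁ q₁ r₂)

-- Motzkin paths containing a non-flat step.
𝓝 : ℕ → Set
𝓝 n = Σ Path λ M → T (isMotzkin n M) × firstNonFlat M ≡ just U

-- Motzkin paths X D Y with a marked D after which Y contains a non-flat step.
𝓓 : ℕ → Set
𝓓 n = Σ (Path × Path) λ (X , Y) → T (isMotzkin n (X ++ D ∷ Y)) × firstNonFlat Y ≡ just U

𝓢 : ℕ → Set
𝓢 n = 𝓝 n ⊎ 𝓓 n

-- Elements of these sets are determined by their paths (and positions):
-- the remaining components are proofs of propositions.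

𝓝-≡ : ∀ {n M M'} {p : T (isMotzkin n M)} {p' : T (isMotzkin n M')} {f f'} → M ≡ M' →
      _≡_ {A = 𝓝 n} (M , p , f) (M' , p' , f')
𝓝-≡ {p = p} {p'} {f} {f'} refl rewrite T-irrelevant p p' | uip f f' = refl

𝓓-≡ : ∀ {n X X' Y Y'} {p : T (isMotzkin n (X ++ D ∷ Y))} {p' : T (isMotzkin n (X' ++ D ∷ Y'))} {f f'} →
      X ≡ X' → Y ≡ Y' → _≡_ {A = 𝓓 n} ((X , Y) , p , f) ((X' , Y') , p' , f')
𝓓-≡ {p = p} {p'} {f} {f'} refl refl rewrite T-irrelevant p p' | uip f f' = refl

𝓗𝓜-≡ : ∀ {n M M' i i'} {p : T (isMotzkin n M)} {p' : T (isMotzkin n M')} {h : HumpAt M i} {h' : HumpAt M' i'} →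
       M ≡ M' → i ≡ i' → _≡_ {A = 𝓗𝓜 n} ((M , p) , i , h) ((M' , p') , i' , h')
𝓗𝓜-≡ {p = p} {p'} {h} {h'} refl refl rewrite T-irrelevant p p' | T-irrelevant h h' = refl

𝓢𝓜U*-≡ : ∀ {n L L'} {p : T (isSuperMotzkin n L)} {p' : T (isSuperMotzkin n L')} {f f'} → L ≡ L' →
         _≡_ {A = 𝓢𝓜U* n} (L , p , f) (L' , p' , f')
𝓢𝓜U*-≡ {p = p} {p'} {f} {f'} refl rewrite T-irrelevant p p' | uip f f' = refl

meander-split-D : ∀ {h e} X Y → Meander h (X ++ D ∷ Y) e → ∃ λ a → Meander h X (suc a) × Meander a Y e
meander-split-D X Y p with meander-split X p
... | suc a , pX , down pY = a , pX , pY

drop-length-++ : ∀ (P R : Path) → drop (length P) (P ++ R) ≡ R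
drop-length-++ []      R = refl
drop-length-++ (_ ∷ P) R = drop-length-++ P R

take-length-++ : ∀ (P R : Path) → take (length P) (P ++ R) ≡ P
take-length-++ []      R = refl
take-length-++ (s ∷ P) R = cong (s ∷_) (take-length-++ P R)

length-take-hump : ∀ i M → T (startsHump (drop i M)) → length (take i M) ≡ i
length-take-hump zero    M       _    = refl
length-take-hump (suc i) (_ ∷ M) hump = cong suc (length-take-hump i M hump)

humpAt⇒startsHump : ∀ M i → HumpAt M i → T (startsHump (drop i M))
humpAt⇒startsHump M i = subst T (isHumpAt-drop M i)

split⇒humpAt : ∀ {M} P R → M ≡ P ++ R → T (startsHump R) → HumpAt M (length P)
split⇒humpAt P R refl hump =
  subst T (sym (trans (isHumpAt-drop (P ++ R) (length P)) (cong startsHump (drop-length-++ P R)))) hump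

firstNonFlat-before-hump : ∀ M i → T (startsHump (drop i M)) → DFree (take i M) → firstNonFlat M ≡ just U
firstNonFlat-before-hump M i hump free =
  subst (λ w → firstNonFlat w ≡ just U) (LP.take++drop≡id i M) (firstNonFlat-humpSplit (take i M) (drop i M) free hump)

reassemble : ∀ M i X G → take i M ≡ X ++ D ∷ G → M ≡ X ++ D ∷ (G ++ drop i M)
reassemble M i X G eq =
  trans (sym (LP.take++drop≡id i M)) (trans (cong (_++ drop i M) eq) (LP.++-assoc X (D ∷ G) (drop i M)))

cutAtLastD : ∀ {n} M → T (isMotzkin n M) → ∀ i → T (startsHump (drop i M)) →
             DFree (take i M) ⊎ LastDSplit (take i M) → 𝓢 n
cutAtLastD M mot i hump (inj₁ free) = inj₁ (M , mot , firstNonFlat-before-hump M i hump free)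
cutAtLastD {n} M mot i hump (inj₂ ((X , G) , eq , G-free)) =
  inj₂ ((X , G ++ drop i M) , subst (λ w → T (isMotzkin n w)) (reassemble M i X G eq) mot ,
        firstNonFlat-humpSplit G (drop i M) G-free hump)

α : ∀ {n} → 𝓗𝓜 n → 𝓢 n
α ((M , mot) , i , hp) = cutAtLastD M mot i (humpAt⇒startsHump M i hp) (lastD (take i M))

firstHump-𝓝 : ∀ {n} (s : 𝓝 n) → HumpSplit (proj₁ s)
firstHump-𝓝 (M , mot , first) = firstHump M first (proj₂ (motzkin⇒ mot)) z≤n

firstHump-𝓓 : ∀ {n} (s : 𝓓 n) → HumpSplit (proj₂ (proj₁ s))
firstHump-𝓓 ((X , Y) , mot , first) =
  firstHump Y first (proj₂ (proj₂ (meander-split-D X Y (proj₂ (motzkin⇒ mot))))) z≤n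

reassemble-𝓓 : ∀ X Y G R → Y ≡ G ++ R → X ++ D ∷ Y ≡ (X ++ D ∷ G) ++ R
reassemble-𝓓 X Y G R eq = trans (cong (λ w → X ++ D ∷ w) eq) (sym (LP.++-assoc X (D ∷ G) R))

markHump-𝓝 : ∀ {n} (s : 𝓝 n) → HumpSplit (proj₁ s) → 𝓗𝓜 n
markHump-𝓝 (M , mot , _) ((P , R) , eq , _ , hump) = (M , mot) , length P , split⇒humpAt P R eq hump

markHump-𝓓 : ∀ {n} (s : 𝓓 n) → HumpSplit (proj₂ (proj₁ s)) → 𝓗𝓜 n
markHump-𝓓 ((X , Y) , mot , _) ((G , R) , eq , _ , hump) =
  (X ++ D ∷ Y , mot) , length (X ++ D ∷ G) , split⇒humpAt (X ++ D ∷ G) R (reassemble-𝓓 X Y G R eq) hump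

α⁻¹ : ∀ {n} → 𝓢 n → 𝓗𝓜 n
α⁻¹ (inj₁ s) = markHump-𝓝 s (firstHump-𝓝 s)
α⁻¹ (inj₂ s) = markHump-𝓓 s (firstHump-𝓓 s)

-- The marked hump is the first hump after the last D preceding it.
α⁻¹-α : ∀ {n} (x : 𝓗𝓜 n) → α⁻¹ (α x) ≡ x
α⁻¹-α {n} ((M , mot) , i , hp) = cases (lastD (take i M))
  where
    hump : T (startsHump (drop i M))
    hump = humpAt⇒startsHump M i hp
    cases : ∀ r → α⁻¹ (cutAtLastD M mot i hump r) ≡ ((M , mot) , i , hp)
    cases (inj₁ free) = marked (firstHump-𝓝 s)
      where
        s : 𝓝 n
        s = (M , mot , firstNonFlat-before-hump M i hump free)
        marked : ∀ hs → markHump-𝓝 s hs ≡ ((M , mot) , i , hp)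
        marked ((P , R) , eq , P-free , hump′) = 𝓗𝓜-≡ refl (begin
          length P          ≡⟨ cong length (humpSplit-unique P (take i M)
                                 (trans (sym eq) (sym (LP.take++drop≡id i M))) P-free free hump′ hump) ⟩
          length (take i M) ≡⟨ length-take-hump i M hump ⟩
          i                 ∎)
          where open ≡-Reasoning
    cases (inj₂ ((X , G) , eq , G-free)) = marked (firstHump-𝓓 s)
      where
        s : 𝓓 n
        s = ((X , G ++ drop i M) , subst (λ w → T (isMotzkin n w)) (reassemble M i X G eq) mot ,
             firstNonFlat-humpSplit G (drop i M) G-free hump)
        marked : ∀ hs → markHump-𝓓 s hs ≡ ((M , mot) , i , hp)
        marked ((G′ , R) , eq′ , G′-free , hump′) = 𝓗𝓜-≡ (sym (reassemble M i X G eq)) (begin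
          length (X ++ D ∷ G′) ≡⟨ cong (λ g → length (X ++ D ∷ g))
                                    (humpSplit-unique G′ G (sym eq′) G′-free G-free hump′ hump) ⟩
          length (X ++ D ∷ G)  ≡⟨ cong length (sym eq) ⟩
          length (take i M)    ≡⟨ length-take-hump i M hump ⟩
          i                    ∎)
          where open ≡-Reasoning

-- The last D before the first hump of Y in X D Y is the marked D.
α-α⁻¹ : ∀ {n} (s : 𝓢 n) → α (α⁻¹ s) ≡ s
α-α⁻¹ (inj₁ s@(M , mot , _)) = marked (firstHump-𝓝 s)
  where
    marked : ∀ hs → α (markHump-𝓝 s hs) ≡ inj₁ s
    marked ((P , R) , eq , P-free , hump) = cases (lastD (take (length P) M))
      where
        prefix : take (length P) M ≡ P
        prefix = trans (cong (take (length P)) eq) (take-length-++ P R)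
        cases : ∀ r → cutAtLastD M mot (length P) (humpAt⇒startsHump M (length P) (split⇒humpAt P R eq hump)) r ≡ inj₁ s
        cases (inj₁ _) = cong inj₁ (𝓝-≡ refl)
        cases (inj₂ ((X , G) , eq′ , _)) = ⊥-elim (DFree-++D-⊥ X G (subst DFree (trans (sym prefix) eq′) P-free))
α-α⁻¹ (inj₂ s@((X , Y) , mot , _)) = marked (firstHump-𝓓 s)
  where
    marked : ∀ hs → α (markHump-𝓓 s hs) ≡ inj₂ s
    marked ((G , R) , eq , G-free , hump) = cases (lastD (take (length (X ++ D ∷ G)) (X ++ D ∷ Y)))
      where
        M-eq : X ++ D ∷ Y ≡ (X ++ D ∷ G) ++ R
        M-eq = reassemble-𝓓 X Y G R eq
        prefix : take (length (X ++ D ∷ G)) (X ++ D ∷ Y) ≡ X ++ D ∷ G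
        prefix = trans (cong (take (length (X ++ D ∷ G))) M-eq) (take-length-++ (X ++ D ∷ G) R)
        suffix : drop (length (X ++ D ∷ G)) (X ++ D ∷ Y) ≡ R
        suffix = trans (cong (drop (length (X ++ D ∷ G))) M-eq) (drop-length-++ (X ++ D ∷ G) R)
        hump′ : T (startsHump (drop (length (X ++ D ∷ G)) (X ++ D ∷ Y)))
        hump′ = humpAt⇒startsHump (X ++ D ∷ Y) (length (X ++ D ∷ G)) (split⇒humpAt (X ++ D ∷ G) R M-eq hump)
        cases : ∀ r → cutAtLastD (X ++ D ∷ Y) mot (length (X ++ D ∷ G)) hump′ r ≡ inj₂ s
        cases (inj₁ free) = ⊥-elim (DFree-++D-⊥ X G (subst DFree prefix free))
        cases (inj₂ ((X′ , G′) , eq′ , G′-free)) =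
          let X-eq , G-eq = lastD-unique X X′ (trans (sym prefix) eq′) G-free G′-free
          in cong inj₂ (𝓓-≡ (sym X-eq) (trans (cong₂ _++_ (sym G-eq) suffix) (sym eq)))

length-swap : ∀ (Y X : Path) → length (Y ++ D ∷ X) ≡ length (X ++ D ∷ Y)
length-swap Y X = begin
  length (Y ++ D ∷ X)          ≡⟨ LP.length-++ Y ⟩
  length Y + suc (length X)    ≡⟨ ℕP.+-suc (length Y) (length X) ⟩
  suc (length Y + length X)    ≡⟨ cong suc (ℕP.+-comm (length Y) (length X)) ⟩
  suc (length X + length Y)    ≡⟨ sym (ℕP.+-suc (length X) (length Y)) ⟩
  length X + suc (length Y)    ≡⟨ sym (LP.length-++ X) ⟩
  length (X ++ D ∷ Y)          ∎
  where open ≡-Reasoning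

height-swap : ∀ (Y X : Path) → height (Y ++ D ∷ X) ≡ height (X ++ D ∷ Y)
height-swap Y X = begin
  height (Y ++ D ∷ X)                   ≡⟨ height-++ Y (D ∷ X) ⟩
  height Y +ℤ (δ D +ℤ height X)         ≡⟨ +ℤ-swap (height Y) (δ D) (height X) ⟩
  height X +ℤ (δ D +ℤ height Y)         ≡⟨ sym (height-++ X (D ∷ Y)) ⟩
  height (X ++ D ∷ Y)                   ∎
  where
    open ≡-Reasoning
    +ℤ-swap : ∀ a b c → a +ℤ (b +ℤ c) ≡ c +ℤ (b +ℤ a)
    +ℤ-swap a b c = trans (ℤP.+-comm a (b +ℤ c)) (trans (cong (_+ℤ a) (ℤP.+-comm b c)) (ℤP.+-assoc c b a))

firstNonFlat-before-D : ∀ Y X → firstNonFlat (Y ++ D ∷ X) ≡ just U → firstNonFlat Y ≡ just U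
firstNonFlat-before-D Y X first with firstNonFlat Y | firstNonFlat-++ Y (D ∷ X)
... | just _  | split = trans (sym split) first
... | nothing | split with trans (sym split) first
...   | ()

firstNonFlat-++D : ∀ Y X → firstNonFlat Y ≡ just U → firstNonFlat (Y ++ D ∷ X) ≡ just U
firstNonFlat-++D Y X first = trans (firstNonFlat-++ Y (D ∷ X)) (cong (_<∣> just D) first)

rotateAtMin : ∀ {n} L → T (isSuperMotzkin n L) → firstNonFlat L ≡ just U → ∃ (Meander 0 L) ⊎ MinSplit L → 𝓢 n
rotateAtMin {n} L sm first (inj₁ (e , p)) =
  inj₁ (L , ⇒motzkin (proj₁ (superMotzkin⇒ {n} {L} sm)) on-axis , first)
  where
    on-axis : Meander 0 L 0
    on-axis = subst (Meander 0 L) (meander-level p (proj₂ (superMotzkin⇒ {n} {L} sm))) p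
rotateAtMin {n} L sm first (inj₂ (a , (Y , X) , eq , q , e , r)) =
  inj₂ ((X , Y) , ⇒motzkin length-XDY rotated , firstNonFlat-before-D Y X (subst (λ w → firstNonFlat w ≡ just U) eq first))
  where
    length-XDY : length (X ++ D ∷ Y) ≡ n
    length-XDY = trans (sym (length-swap Y X)) (trans (cong length (sym eq)) (proj₁ (superMotzkin⇒ {n} {L} sm)))
    rotated : Meander 0 (X ++ D ∷ Y) 0
    rotated = meander-++ (subst (Meander 0 X) (minSplit-end (trans (cong height (sym eq)) (proj₂ (superMotzkin⇒ {n} {L} sm))) q r) r)
                         (down q)

β : ∀ {n} → 𝓢𝓜U* n → 𝓢 n
β (L , sm , first) = rotateAtMin L sm first (minSplit L)

β⁻¹ : ∀ {n} → 𝓢 n → 𝓢𝓜U* n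
β⁻¹ {n} (inj₁ (M , mot , first)) = M , motzkin⇒superMotzkin {n} {M} mot , first
β⁻¹ {n} (inj₂ ((X , Y) , mot , first)) =
  Y ++ D ∷ X , ⇒superMotzkin {n} {Y ++ D ∷ X} (trans (length-swap Y X) l) (trans (height-swap Y X) h0) , firstNonFlat-++D Y X first
  where
    l : length (X ++ D ∷ Y) ≡ n
    l  = proj₁ (superMotzkin⇒ {n} {X ++ D ∷ Y} (motzkin⇒superMotzkin {n} {X ++ D ∷ Y} mot))
    h0 : height (X ++ D ∷ Y) ≡ + 0
    h0 = proj₂ (superMotzkin⇒ {n} {X ++ D ∷ Y} (motzkin⇒superMotzkin {n} {X ++ D ∷ Y} mot))

β⁻¹-β : ∀ {n} (y : 𝓢𝓜U* n) → β⁻¹ (β y) ≡ y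
β⁻¹-β (L , sm , first) = cases (minSplit L)
  where
    cases : ∀ r → β⁻¹ (rotateAtMin L sm first r) ≡ (L , sm , first)
    cases (inj₁ _)                      = 𝓢𝓜U*-≡ refl
    cases (inj₂ (_ , _ , eq , _ , _))   = 𝓢𝓜U*-≡ (sym eq)

-- A Motzkin path has no MinSplit, and in a rotated path X D Y ∈ 𝓓 the
-- marked D is the one reaching the global minimum of Y D X.
β-β⁻¹ : ∀ {n} (s : 𝓢 n) → β (β⁻¹ s) ≡ s
β-β⁻¹ {n} (inj₁ (M , mot , first)) = cases (minSplit M)
  where
    cases : ∀ r → rotateAtMin M (motzkin⇒superMotzkin {n} {M} mot) first r ≡ inj₁ (M , mot , first)
    cases (inj₁ _) = cong inj₁ (𝓝-≡ refl)
    cases (inj₂ (_ , (Y , X) , eq , q , _)) =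
      ⊥-elim (minSplit-nonneg-⊥ Y X (subst (λ w → Meander 0 w 0) eq (proj₂ (motzkin⇒ mot))) q)
β-β⁻¹ (inj₂ s@((X , Y) , mot , _)) = cases (minSplit (Y ++ D ∷ X))
  where
    split : ∃ λ a → Meander 0 X (suc a) × Meander a Y 0
    split = meander-split-D X Y (proj₂ (motzkin⇒ mot))
    cases : ∀ r → rotateAtMin (Y ++ D ∷ X) (proj₁ (proj₂ (β⁻¹ (inj₂ s)))) (proj₂ (proj₂ (β⁻¹ (inj₂ s)))) r
                  ≡ inj₂ s
    cases (inj₁ (_ , p)) = ⊥-elim (minSplit-nonneg-⊥ Y X p (proj₂ (proj₂ split)))
    cases (inj₂ (_ , (Y′ , X′) , eq , q , _ , r)) =
      let Y-eq , X-eq = minSplit-unique Y′ Y X′ X (sym eq) q r (proj₂ (proj₂ split)) (proj₁ (proj₂ split))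
      in cong inj₂ (𝓓-≡ X-eq Y-eq)

HumpRelation : Path → Path → Set
HumpRelation L M = (lastNonFlat L ≡ just U × numHumps M ≡ suc (numHumps L))
                 ⊎ (lastNonFlat L ≡ just D × numHumps M ≡ numHumps L)

+-rotate₁ : ∀ x y → x + 1 + y ≡ suc (y + 0 + x)
+-rotate₁ = solve-∀

+-rotate₀ : ∀ x y → x + 0 + y ≡ y + 0 + x
+-rotate₀ = solve-∀

-- Rotating Y D X to X D Y, where Y ends with a D, changes the hump count
-- only by the hump formed by the end of X and the marked D.
humps-rotate : ∀ X Y → lastNF Y ≡ just D → HumpRelation (Y ++ D ∷ X) (X ++ D ∷ Y)
humps-rotate X Y Y-last
  rewrite numHumps≡humpCount (X ++ D ∷ Y) | numHumps≡humpCount (Y ++ D ∷ X)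
        | lastNonFlat≡lastNF (Y ++ D ∷ X) | humpCount-++D X Y | humpCount-++D Y X
        | lastNF-++ Y (D ∷ X) | Y-last
  with lastNF X in X-last
... | just U  = inj₁ (refl , +-rotate₁ (humpCount X) (humpCount Y))
... | just D  = inj₂ (refl , +-rotate₀ (humpCount X) (humpCount Y))
... | just F  = ⊥-elim (lastNF≢F X X-last)
... | nothing = inj₂ (refl , +-rotate₀ (humpCount X) (humpCount Y))

pathOf : ∀ {n} → 𝓢 n → Path
pathOf (inj₁ (M , _))       = M
pathOf (inj₂ ((X , Y) , _)) = X ++ D ∷ Y

pathOf-α : ∀ {n} (x : 𝓗𝓜 n) → pathOf (α x) ≡ proj₁ (proj₁ x)
pathOf-α ((M , mot) , i , hp) = cases (lastD (take i M))
  where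
    cases : ∀ r → pathOf (cutAtLastD M mot i (humpAt⇒startsHump M i hp) r) ≡ M
    cases (inj₁ _)                    = refl
    cases (inj₂ ((X , G) , eq , _)) = sym (reassemble M i X G eq)

humps-β⁻¹ : ∀ {n} (s : 𝓢 n) → HumpRelation (proj₁ (β⁻¹ s)) (pathOf s)
humps-β⁻¹ (inj₁ (M , mot , first)) =
  inj₂ (trans (lastNonFlat≡lastNF M) (meander-lastNF-D M (proj₂ (motzkin⇒ mot)) first) , refl)
humps-β⁻¹ (inj₂ ((X , Y) , mot , first)) =
  humps-rotate X Y (meander-lastNF-D Y (proj₂ (proj₂ (meander-split-D X Y (proj₂ (motzkin⇒ mot))))) first)

hump-statistic : ∀ L M k → firstNonFlat L ≡ just U → HumpRelation L M →
  (numHumps M ≡ k) ⇔ ((Σ ℕ λ j → suc j ≡ k × InUU j L) ⊎ InUD k L)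
hump-statistic L M k first (inj₁ (last , rel)) = mk⇔
  (λ M-k → inj₁ (numHumps L , trans (sym rel) M-k , refl , first , last))
  λ { (inj₁ (j , refl , L-j , _)) → trans rel (cong suc L-j)
    ; (inj₂ (_ , _ , last′))      → ⊥-elim (U≢D (trans (sym last) last′)) }
  where U≢D : just U ≢ just D
        U≢D ()
hump-statistic L M k first (inj₂ (last , rel)) = mk⇔
  (λ M-k → inj₂ (trans (sym rel) M-k , first , last))
  λ { (inj₁ (_ , _ , _ , _ , last′)) → ⊥-elim (D≢U (trans (sym last) last′))
    ; (inj₂ (L-k , _))              → trans rel L-k }
  where D≢U : just D ≢ just U
        D≢U ()

Φ : ∀ {n} → 𝓗𝓜 n → 𝓢𝓜U* n
Φ x = β⁻¹ (α x)

Φ-inverse : ∀ n → 𝓗𝓜 n ↔ 𝓢𝓜U* n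
Φ-inverse n = mk↔ₛ′ Φ (λ y → α⁻¹ (β y))
  (λ y → trans (cong β⁻¹ (α-α⁻¹ (β y))) (β⁻¹-β y))
  (λ x → trans (cong α⁻¹ (β-β⁻¹ (α x))) (α⁻¹-α x))

theorem1p1 : (n : ℕ) →
    Σ (𝓗𝓜 n → 𝓢𝓜U* n) λ Φ →
      Bijective _≡_ _≡_ Φ ×
      ((MP : 𝓗𝓜 n) (k : ℕ) →
        (numHumps (proj₁ (proj₁ MP)) ≡ k) ⇔
        ((Σ ℕ λ j → suc j ≡ k × InUU j (proj₁ (Φ MP))) ⊎ InUD k (proj₁ (Φ MP))))
theorem1p1 n = Φ , Bijection.bijective (↔⇒⤖ (Φ-inverse n)) , statistic
  where
    statistic : (MP : 𝓗𝓜 n) (k : ℕ) → (numHumps (proj₁ (proj₁ MP)) ≡ k) ⇔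
                ((Σ ℕ λ j → suc j ≡ k × InUU j (proj₁ (Φ MP))) ⊎ InUD k (proj₁ (Φ MP)))
    statistic MP k = hump-statistic (proj₁ (Φ MP)) (proj₁ (proj₁ MP)) k (proj₂ (proj₂ (Φ MP)))
      (subst (HumpRelation (proj₁ (Φ MP))) (pathOf-α MP) (humps-β⁻¹ (α MP)))
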